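{- Let $n\in\mathbb N$ and let $A\subseteq\mathbb Z_n\setminus\{0\}$ be nonempty with $A=-A$. If $C_n(A)$ has nonadjacent twins, then $\gcd(n,|A|)>1$, and the size of each nonadjacent twin class divides $\gcd(n,|A|)$.
   Context: The circulant graph $C_n(A)$ has vertex set $\mathbb Z_n$, with $u,v$ adjacent iff $u-v\in A$. Distinct vertices $u,v$ are nonadjacent twins if $N(u)=N(v)$ (open neighborhoods); the nonadjacent twin classes are the equivalence classes of the relation $N(u)=N(v)$. -}

module Defs where

open import Data.Nat using (ℕ; zero; suc; _+_; _∸_; NonZero)
open import Data.Nat.DivMod using (_%_; m%n<n)
open import Data.Fin using (Fin; toℕ; fromℕ<)
open import Data.Fin.Subset using (Subset; _∈_)
open import Data.Product using (_×_; Σ)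
open import Relation.Binary.PropositionalEquality using (_≡_; _≢_)

-- Z_n represented by Fin n (n nonzero); arithmetic via representatives mod n.
module _ {n : ℕ} .{{_ : NonZero n}} where

  _⊖_ : Fin n → Fin n → Fin n
  u ⊖ v = fromℕ< (m%n<n (toℕ u + (n ∸ toℕ v)) n)

  ⊝_ : Fin n → Fin n
  ⊝ a = fromℕ< (m%n<n (n ∸ toℕ a) n)

  Adj : Subset n → Fin n → Fin n → Set
  Adj A u v = (u ⊖ v) ∈ A

  SameNbhd : Subset n → Fin n → Fin n → Set
  SameNbhd A u v = (w : Fin n) → (Adj A u w → Adj A v w) × (Adj A v w → Adj A u w)

  HasTwins : Subset n → Set
  HasTwins A = Σ (Fin n) λ u → Σ (Fin n) λ v → (u ≢ v) × SameNbhd A u v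

  IsTwinClassOf : Subset n → Fin n → Subset n → Set
  IsTwinClassOf A u s = (v : Fin n) → (v ∈ s → SameNbhd A u v) × (SameNbhd A u v → v ∈ s)

{-# OPTIONS --safe #-}
module Submission where

-- The neighbourhood of u in C_n(A) is determined by the translate y ↦ [u + y ∈ A]
-- of the indicator of A, so u and v are twins iff u − v is a period of that indicator.
-- If g is its least positive period, then g ∣ n and the twin classes are the residue
-- classes modulo g, each of size q = n / g.  The indicator is g-periodic, so A is a
-- union of such classes and q ∣ |A| as well; two distinct twins force g < n, i.e. q > 1.

open import Defs
open import Data.Bool using (Bool; true; false; if_then_else_)
open import Data.Bool.Properties using (T-≡; ⇔→≡) renaming (_≟_ to _≟ᵇ_)
open import Data.Fin using (Fin; zero; suc; toℕ; opposite)
open import Data.Fin.Properties using (toℕ<n; toℕ-injective; toℕ-fromℕ<; fromℕ<-cong; fromℕ<-toℕ; opposite-prop; all?)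
open import Data.Fin.Subset using (Subset; _∈_; ∣_∣; Nonempty)
open import Data.Nat using (ℕ; zero; suc; NonZero; _+_; _*_; _∸_; _≤_; _<_; _≡ᵇ_; z<s; s<s; s<s⁻¹; _<?_; >-nonZero; >-nonZero⁻¹; ≢-nonZero; ≢-nonZero⁻¹)
open import Data.Nat.DivMod using (_%_; _/_; _mod_; m%n<n; m≡m%n+[m/n]*n; [m+n]%n≡m%n; m<n⇒m%n≡m)
open import Data.Nat.Divisibility using (_∣_; quotient; quotient-∣; quotient>1; m∣n⇒n≡quotient*m; m%n≡0⇒n∣m; m∣m*n; ∣⇒≤)
open import Data.Nat.GCD using (gcd; gcd-greatest; gcd[m,n]≢0)
open import Data.Nat.Induction using (<-rec)
open import Data.Nat.Properties
open import Algebra.Properties.CommutativeSemigroup +-commutativeSemigroup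
  using (interchange; x∙yz≈y∙xz; xy∙z≈y∙xz)
open import Data.Product using (_×_; _,_; proj₁; proj₂)
open import Data.Sum using (inj₁; inj₂)
open import Data.Vec using ([]; _∷_; lookup)
open import Data.Vec.Properties using ([]=⇒lookup; lookup⇒[]=)
open import Function using (_∘_; id; mk⇔; Equivalence)
open import Level using (Level)
open import Relation.Binary.PropositionalEquality using (_≡_; _≢_; refl; sym; trans; cong; cong₂; subst; subst₂; module ≡-Reasoning)
open import Relation.Nullary using (Dec; yes; no; ¬_; contradiction)
open import Relation.Nullary.Decidable using (map′; _×-dec_)
open import Relation.Unary using (Pred; Decidable)

open ≡-Reasoning

record Least {ℓ : Level} (P : Pred ℕ ℓ) : Set ℓ where
  field
    value   : ℕ
    holds   : P value
    minimal : ∀ {i} → i < value → ¬ P i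

least : ∀ {ℓ} {P : Pred ℕ ℓ} → Decidable P → ∀ {k} → P k → Least P
least {P = P} P? {k} = <-rec (λ k → P k → Least P) step k
  where
  step : ∀ k → (∀ {i} → i < k → P i → Least P) → P k → Least P
  step k below Pk with anyUpTo? P? k
  ... | yes (i , i<k , Pi) = below i<k Pi
  ... | no none            = record { value = k ; holds = Pk ; minimal = λ i<k Pi → none (_ , i<k , Pi) }

Periodic : {A : Set} → ℕ → (ℕ → A) → Set
Periodic p f = ∀ x → f (p + x) ≡ f x

module _ {A : Set} {f : ℕ → A} {p : ℕ} (f-periodic : Periodic p f) where

  periodic-* : ∀ k → Periodic (k * p) f
  periodic-* zero    x = refl
  periodic-* (suc k) x = begin
    f (p + k * p + x)   ≡⟨ cong f (+-assoc p (k * p) x) ⟩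
    f (p + (k * p + x)) ≡⟨ f-periodic (k * p + x) ⟩
    f (k * p + x)       ≡⟨ periodic-* k x ⟩
    f x                 ∎

  periodic-shift : ∀ t → Periodic p (λ y → f (t + y))
  periodic-shift t y = trans (cong f (x∙yz≈y∙xz t p y)) (f-periodic (t + y))

  periodic-% : .{{_ : NonZero p}} → ∀ x → f x ≡ f (x % p)
  periodic-% x = begin
    f x                     ≡⟨ cong f (m≡m%n+[m/n]*n x p) ⟩
    f (x % p + x / p * p)   ≡⟨ cong f (+-comm (x % p) _) ⟩
    f (x / p * p + x % p)   ≡⟨ periodic-* (x / p) (x % p) ⟩
    f (x % p)               ∎

periodic-ext : ∀ {A : Set} {f h : ℕ → A} {p} .{{_ : NonZero p}} → Periodic p f → Periodic p h →
               (∀ (i : Fin p) → f (toℕ i) ≡ h (toℕ i)) → ∀ x → f x ≡ h x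
periodic-ext {f = f} {h} {p} f-periodic h-periodic agree x = begin
  f x                  ≡⟨ periodic-% f-periodic x ⟩
  f (x % p)            ≡⟨ cong f (toℕ-fromℕ< (m%n<n x p)) ⟨
  f (toℕ (x mod p))    ≡⟨ agree (x mod p) ⟩
  h (toℕ (x mod p))    ≡⟨ cong h (toℕ-fromℕ< (m%n<n x p)) ⟩
  h (x % p)            ≡⟨ periodic-% h-periodic x ⟨
  h x                  ∎

toℕ-mod : ∀ {n} .{{_ : NonZero n}} (i : Fin n) → toℕ i mod n ≡ i
toℕ-mod {n} i = trans (fromℕ<-cong _ _ (m<n⇒m%n≡m (toℕ<n i)) (m%n<n (toℕ i) n) (toℕ<n i)) (fromℕ<-toℕ i (toℕ<n i))

count : (ℕ → Bool) → ℕ → ℕ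
count f zero    = 0
count f (suc k) = (if f 0 then suc else id) (count (f ∘ suc) k)

count-cong : ∀ {f h} k → (∀ {i} → i < k → f i ≡ h i) → count f k ≡ count h k
count-cong zero    _   = refl
count-cong (suc k) f≗h = cong₂ (λ b c → (if b then suc else id) c) (f≗h z<s) (count-cong k (f≗h ∘ s<s))

count-+ : ∀ f j k → count f (j + k) ≡ count f j + count (λ i → f (j + i)) k
count-+ f zero    k = refl
count-+ f (suc j) k with f 0
... | true  = cong suc (count-+ (f ∘ suc) j k)
... | false = count-+ (f ∘ suc) j k

count-periodic : ∀ {f g} → Periodic g f → ∀ q → count f (q * g) ≡ q * count f g
count-periodic _ zero = refl
count-periodic {f} {g} f-periodic (suc q) = begin
  count f (g + q * g)                          ≡⟨ count-+ f g (q * g) ⟩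
  count f g + count (λ i → f (g + i)) (q * g)  ≡⟨ cong (count f g +_) (count-cong (q * g) (λ {i} _ → f-periodic i)) ⟩
  count f g + count f (q * g)                  ≡⟨ cong (count f g +_) (count-periodic f-periodic q) ⟩
  count f g + q * count f g                    ∎

count-false : ∀ k → count (λ _ → false) k ≡ 0
count-false zero    = refl
count-false (suc k) = count-false k

count-≡ᵇ : ∀ {r k} → r < k → count (_≡ᵇ r) k ≡ 1
count-≡ᵇ {zero}  {suc k} _   = cong suc (count-false k)
count-≡ᵇ {suc r} {suc k} r<k = count-≡ᵇ (s<s⁻¹ r<k)

count-residue : ∀ {g} .{{_ : NonZero g}} q {r} → r < g → count (λ i → i % g ≡ᵇ r) (q * g) ≡ q
count-residue {g} q {r} r<g = begin
  count (λ i → i % g ≡ᵇ r) (q * g)  ≡⟨ count-periodic residue-periodic q ⟩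
  q * count (λ i → i % g ≡ᵇ r) g    ≡⟨ cong (q *_) (count-cong g (λ i<g → cong (_≡ᵇ r) (m<n⇒m%n≡m i<g))) ⟩
  q * count (_≡ᵇ r) g               ≡⟨ cong (q *_) (count-≡ᵇ r<g) ⟩
  q * 1                             ≡⟨ *-identityʳ q ⟩
  q                                 ∎
  where
  residue-periodic : Periodic g (λ i → i % g ≡ᵇ r)
  residue-periodic i = cong (_≡ᵇ r) (trans (cong (_% g) (+-comm g i)) ([m+n]%n≡m%n i g))

∣p∣≡count : ∀ {n f} (p : Subset n) → (∀ i → lookup p i ≡ f (toℕ i)) → ∣ p ∣ ≡ count f n
∣p∣≡count []          _   = refl
∣p∣≡count (true ∷ p)  p≗f rewrite sym (p≗f zero) = cong suc (∣p∣≡count p (p≗f ∘ suc))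
∣p∣≡count (false ∷ p) p≗f rewrite sym (p≗f zero) = ∣p∣≡count p (p≗f ∘ suc)

module Translates {N : ℕ} .{{_ : NonZero N}} (a : ℕ → Bool) (a-periodic : Periodic N a) where

  infix 4 _≈_
  _≈_ : ℕ → ℕ → Set
  u ≈ v = ∀ y → a (u + y) ≡ a (v + y)

  ≈-sym : ∀ {u v} → u ≈ v → v ≈ u
  ≈-sym u≈v y = sym (u≈v y)

  ≈-trans : ∀ {u v w} → u ≈ v → v ≈ w → u ≈ w
  ≈-trans u≈v v≈w y = trans (u≈v y) (v≈w y)

  ≈-fromFin : ∀ {u v} → (∀ (i : Fin N) → a (u + toℕ i) ≡ a (v + toℕ i)) → u ≈ v
  ≈-fromFin = periodic-ext (periodic-shift a-periodic _) (periodic-shift a-periodic _)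

  _≈?_ : ∀ u v → Dec (u ≈ v)
  u ≈? v = map′ ≈-fromFin (λ u≈v i → u≈v (toℕ i)) (all? (λ i → a (u + toℕ i) ≟ᵇ a (v + toℕ i)))

  +period≈ : ∀ {p} → Periodic p a → ∀ x → x + p ≈ x
  +period≈ {p} p-periodic x y = trans (cong a (xy∙z≈y∙xz x p y)) (p-periodic (x + y))

  -- t is cancelled by adding t·N − t, which changes nothing up to the period N.
  ≈-cancelˡ : ∀ t {u v} → t + u ≈ t + v → u ≈ v
  ≈-cancelˡ t {u} {v} t+u≈t+v y = begin
    a (u + y)             ≡⟨ periodic-* a-periodic t (u + y) ⟨
    a (t * N + (u + y))   ≡⟨ cong a (unshift u) ⟩
    a (t + u + (e + y))   ≡⟨ t+u≈t+v (e + y) ⟩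
    a (t + v + (e + y))   ≡⟨ cong a (unshift v) ⟨
    a (t * N + (v + y))   ≡⟨ periodic-* a-periodic t (v + y) ⟩
    a (v + y)             ∎
    where
    e : ℕ
    e = t * N ∸ t
    unshift : ∀ x → t * N + (x + y) ≡ t + x + (e + y)
    unshift x = trans (cong (_+ (x + y)) (sym (m+[n∸m]≡n (m≤m*n t N)))) (interchange t e x y)

  private
    leastPeriod : Least (λ d → 0 < d × Periodic d a)
    leastPeriod = least (λ d → (0 <? d) ×-dec (d ≈? 0)) (>-nonZero⁻¹ N , a-periodic)

  g : ℕ
  g = Least.value leastPeriod

  instance
    g-nonZero : NonZero g
    g-nonZero = >-nonZero (proj₁ (Least.holds leastPeriod))

  g-periodic : Periodic g a
  g-periodic = proj₂ (Least.holds leastPeriod)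

  g-minimal : ∀ {d} → d < g → Periodic d a → d ≡ 0
  g-minimal {zero}  _   _          = refl
  g-minimal {suc d} d<g d-periodic = contradiction (z<s , d-periodic) (Least.minimal leastPeriod d<g)

  ≈-%g : ∀ u → u ≈ u % g
  ≈-%g u = subst (_≈ u % g) (sym (m≡m%n+[m/n]*n u g)) (+period≈ (periodic-* g-periodic (u / g)) (u % g))

  residue-≈-injective : ∀ {r s} → r ≤ s → s < g → s ≈ r → r ≡ s
  residue-≈-injective {r} {s} r≤s s<g s≈r =
    ≤-antisym r≤s (m∸n≡0⇒m≤n (g-minimal (≤-<-trans (m∸n≤m s r) s<g) d-periodic))
    where
    d-periodic : Periodic (s ∸ r) a
    d-periodic = ≈-cancelˡ r (subst₂ _≈_ (sym (m+[n∸m]≡n r≤s)) (sym (+-identityʳ r)) s≈r)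

  ≈⇒%≡ : ∀ {u v} → u ≈ v → u % g ≡ v % g
  ≈⇒%≡ {u} {v} u≈v with ≤-total (u % g) (v % g)
  ... | inj₁ u≤v = residue-≈-injective u≤v (m%n<n v g) (≈-trans (≈-sym (≈-%g v)) (≈-trans (≈-sym u≈v) (≈-%g u)))
  ... | inj₂ v≤u = sym (residue-≈-injective v≤u (m%n<n u g) (≈-trans (≈-sym (≈-%g u)) (≈-trans u≈v (≈-%g v))))

  %≡⇒≈ : ∀ {u v} → u % g ≡ v % g → u ≈ v
  %≡⇒≈ {u} {v} eq = ≈-trans (≈-%g u) (subst (_≈ v) (sym eq) (≈-sym (≈-%g v)))

  g∣N : g ∣ N
  g∣N = m%n≡0⇒n∣m N g (trans (≈⇒%≡ {v = 0} a-periodic) (m<n⇒m%n≡m (>-nonZero⁻¹ g)))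

  q : ℕ
  q = quotient g∣N

  N≡q*g : N ≡ q * g
  N≡q*g = m∣n⇒n≡quotient*m g∣N

module CirculantTwins {n : ℕ} .{{_ : NonZero n}} (A : Subset n) where

  a : ℕ → Bool
  a x = lookup A (x mod n)

  a-periodic : Periodic n a
  a-periodic x = cong (lookup A)
    (fromℕ<-cong _ _ (trans (cong (_% n) (+-comm n x)) ([m+n]%n≡m%n x n)) (m%n<n (n + x) n) (m%n<n x n))

  open Translates a a-periodic public

  ≈⇒sameNbhd : ∀ {u v} → toℕ u ≈ toℕ v → SameNbhd A u v
  ≈⇒sameNbhd u≈v w = (λ adj → lookup⇒[]= _ A (trans (sym (u≈v _)) ([]=⇒lookup adj)))
                   , (λ adj → lookup⇒[]= _ A (trans (u≈v _) ([]=⇒lookup adj)))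

  -- Neighbourhoods only see the shifts n − w ∈ [1, n], i.e. the translates of 1 + u and 1 + v.
  sameNbhd⇒≈ : ∀ {u v} → SameNbhd A u v → toℕ u ≈ toℕ v
  sameNbhd⇒≈ {u} {v} same = ≈-cancelˡ 1 (≈-fromFin λ i →
    trans (cong a (sym (shift (toℕ u) i))) (trans (agree (opposite i)) (cong a (shift (toℕ v) i))))
    where
    agree : ∀ w → a (toℕ u + (n ∸ toℕ w)) ≡ a (toℕ v + (n ∸ toℕ w))
    agree w = ⇔→≡ (mk⇔ (λ e → []=⇒lookup (proj₁ (same w) (lookup⇒[]= _ A e)))
                       (λ e → []=⇒lookup (proj₂ (same w) (lookup⇒[]= _ A e))))
    shift : ∀ x (i : Fin n) → x + (n ∸ toℕ (opposite i)) ≡ suc x + toℕ i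
    shift x i = begin
      x + (n ∸ toℕ (opposite i))  ≡⟨ cong (λ j → x + (n ∸ j)) (opposite-prop i) ⟩
      x + (n ∸ (n ∸ suc (toℕ i))) ≡⟨ cong (x +_) (m∸[m∸n]≡n (toℕ<n i)) ⟩
      x + suc (toℕ i)             ≡⟨ +-suc x (toℕ i) ⟩
      suc x + toℕ i               ∎

  twinClass-size : ∀ {u s} → IsTwinClassOf A u s → ∣ s ∣ ≡ q
  twinClass-size {u} {s} class = begin
    ∣ s ∣                                   ≡⟨ ∣p∣≡count s lookup-s ⟩
    count (λ i → i % g ≡ᵇ toℕ u % g) n       ≡⟨ cong (count _) N≡q*g ⟩
    count (λ i → i % g ≡ᵇ toℕ u % g) (q * g) ≡⟨ count-residue q (m%n<n (toℕ u) g) ⟩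
    q                                       ∎
    where
    lookup-s : ∀ v → lookup s v ≡ (toℕ v % g ≡ᵇ toℕ u % g)
    lookup-s v = ⇔→≡ (mk⇔
      (Equivalence.to T-≡ ∘ ≡⇒≡ᵇ _ _ ∘ sym ∘ ≈⇒%≡ ∘ sameNbhd⇒≈ ∘ proj₁ (class v) ∘ lookup⇒[]= v s)
      ([]=⇒lookup ∘ proj₂ (class v) ∘ ≈⇒sameNbhd ∘ %≡⇒≈ ∘ sym ∘ ≡ᵇ⇒≡ _ _ ∘ Equivalence.from T-≡))

  q∣∣A∣ : q ∣ ∣ A ∣
  q∣∣A∣ = subst (q ∣_) (sym ∣A∣≡q*count) (m∣m*n (count a g))
    where
    ∣A∣≡q*count : ∣ A ∣ ≡ q * count a g
    ∣A∣≡q*count = begin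
      ∣ A ∣            ≡⟨ ∣p∣≡count A (λ i → cong (lookup A) (sym (toℕ-mod i))) ⟩
      count a n        ≡⟨ cong (count a) N≡q*g ⟩
      count a (q * g)  ≡⟨ count-periodic g-periodic q ⟩
      q * count a g    ∎

  -- Distinct vertices are distinct residues modulo n, while twins agree modulo g.
  twins⇒1<q : ∀ {u v} → u ≢ v → SameNbhd A u v → 1 < q
  twins⇒1<q {u} {v} u≢v same = quotient>1 g∣N (≤∧≢⇒< (∣⇒≤ g∣N) g≢n)
    where
    g≢n : g ≢ n
    g≢n g≡n = u≢v (toℕ-injective (begin
      toℕ u      ≡⟨ m<n⇒m%n≡m (below-g u) ⟨
      toℕ u % g  ≡⟨ ≈⇒%≡ (sameNbhd⇒≈ same) ⟩
      toℕ v % g  ≡⟨ m<n⇒m%n≡m (below-g v) ⟩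
      toℕ v      ∎))
      where
      below-g : ∀ w → toℕ w < g
      below-g w = subst (toℕ w <_) (sym g≡n) (toℕ<n w)

corollary15 : (n : ℕ) .{{_ : NonZero n}} (A : Subset n) →
    Nonempty A →
    ((a : Fin n) → a ∈ A → toℕ a ≢ 0) →
    ((a : Fin n) → a ∈ A → (⊝ a) ∈ A) →
    HasTwins A →
    (1 < gcd n (∣ A ∣)) ×
    ((u : Fin n) (s : Subset n) → IsTwinClassOf A u s → (∣ s ∣) ∣ gcd n (∣ A ∣))
corollary15 n A _ _ _ (u , v , u≢v , same) = 1<gcd , twinClass∣gcd
  where
  open CirculantTwins A

  q∣gcd : q ∣ gcd n (∣ A ∣)
  q∣gcd = gcd-greatest (quotient-∣ g∣N) q∣∣A∣

  1<gcd : 1 < gcd n (∣ A ∣)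
  1<gcd = <-≤-trans (twins⇒1<q u≢v same) (∣⇒≤ q∣gcd)
    where
    instance
      gcd-nonZero : NonZero (gcd n (∣ A ∣))
      gcd-nonZero = ≢-nonZero (gcd[m,n]≢0 n (∣ A ∣) (inj₁ (≢-nonZero⁻¹ n)))

  twinClass∣gcd : (w : Fin n) (s : Subset n) → IsTwinClassOf A w s → ∣ s ∣ ∣ gcd n (∣ A ∣)
  twinClass∣gcd _ _ class = subst (_∣ gcd n (∣ A ∣)) (sym (twinClass-size class)) q∣gcd
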